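{- For integers $1\le k\le r$ we have $\gcd(H_{r,k},H_{r-1,k})=1$ and $\gcd(H_{r,k},H_{r-1,k-1})=1$.
   Context: $F_n$ denotes the Fibonacci numbers ($F_0=0$, $F_1=1$, $F_{n}=F_{n-1}+F_{n-2}$), extended to negative indices by $F_{ -n}=(-1)^{n-1}F_n$. For integers $r,k$, $H_{r,k}=F_{k+1}F_{r-k+2}-F_kF_{r-k+1}=F_{k-1}F_{r-k+2}+F_kF_{r-k}$. -}

module Defs where

open import Data.Nat as ℕ using (ℕ; zero; suc)
open import Data.Integer using (ℤ; +_; -[1+_]; _+_; _-_; _*_; -_)

fibℕ : ℕ → ℕ
fibℕ zero = zero
fibℕ (suc zero) = suc zero
fibℕ (suc (suc n)) = fibℕ (suc n) ℕ.+ fibℕ n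

altSign : ℕ → ℤ → ℤ
altSign zero x = x
altSign (suc m) x = - altSign m x

-- Fibonacci numbers extended to ℤ by F₋ₙ = (-1)^(n-1) Fₙ
F : ℤ → ℤ
F (+ n) = + fibℕ n
F -[1+ m ] = altSign m (+ fibℕ (suc m))

H : ℤ → ℤ → ℤ
H r k = F (k + + 1) * F (r - k + + 2) - F k * F (r - k + + 1)

-- For fixed k the sequence d ↦ H_{k+d,k} is a linear combination of shifts of F, and for fixed d
-- so is k ↦ H_{k+d,k}; hence both satisfy the Fibonacci recurrence on all of ℤ. For any integer
-- sequence with s (n + 2) = s (n + 1) + s n, Euclid's step gcd (a + b) a = gcd b a shows that
-- gcd (s (n + 1)) (s n) does not depend on n ∈ ℤ. Evaluating at a convenient index, where the two
-- values are F_{k+1}, -F_k (resp. F_{d+2}, -F_{d+1}), reduces both claims to the coprimality of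
-- consecutive Fibonacci numbers, which is the same argument applied to F itself.
module Submission where

open import Defs
open import Data.Integer using (ℤ; +_; _≤_; _-_)
open import Data.Integer.GCD using (gcd)
open import Data.Product using (_×_)
open import Relation.Binary.PropositionalEquality using (_≡_)

open import Data.Nat as ℕ using (zero; suc)
import Data.Nat.Properties as ℕ
import Data.Nat.Divisibility as ℕ
open import Data.Integer using (-[1+_]; _+_; _*_; -_)
open import Data.Integer.Properties using (neg-distrib-+; ∣-i∣≡∣i∣; *-comm)
open import Data.Integer.Divisibility using (_∣_)
open import Data.Integer.Divisibility.Signed using (∣ᵤ⇒∣; ∣⇒∣ᵤ; ∣m∣n⇒∣m+n; ∣m+n∣m⇒∣n)
open import Data.Integer.GCD using (gcd[i,j]∣i; gcd[i,j]∣j; gcd-greatest; gcd-comm)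
open import Data.Integer.Tactic.RingSolver using (solve-∀)
open import Data.Product using (_,_)
open import Relation.Binary.PropositionalEquality
  using (refl; sym; trans; cong; cong₂; module ≡-Reasoning)

gcd[i+j,i]≡gcd[j,i] : ∀ i j → gcd (i + j) i ≡ gcd j i
gcd[i+j,i]≡gcd[j,i] i j = cong +_ (ℕ.∣-antisym
  (gcd-greatest {j} {i} {g} g∣j (gcd[i,j]∣j (i + j) i))
  (gcd-greatest {i + j} {i} {g′} g′∣i+j (gcd[i,j]∣j j i)))
  where
  g g′ : ℤ
  g  = gcd (i + j) i
  g′ = gcd j i

  g∣j : g ∣ j
  g∣j = ∣⇒∣ᵤ (∣m+n∣m⇒∣n (∣ᵤ⇒∣ {g} {i + j} (gcd[i,j]∣i (i + j) i))
                         (∣ᵤ⇒∣ {g} {i} (gcd[i,j]∣j (i + j) i)))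

  g′∣i+j : g′ ∣ i + j
  g′∣i+j = ∣⇒∣ᵤ (∣m∣n⇒∣m+n (∣ᵤ⇒∣ {g′} {i} (gcd[i,j]∣j j i))
                           (∣ᵤ⇒∣ {g′} {j} (gcd[i,j]∣i j i)))

gcd[i,-j]≡gcd[i,j] : ∀ i j → gcd i (- j) ≡ gcd i j
gcd[i,-j]≡gcd[i,j] i j = cong (λ n → gcd i (+ n)) (∣-i∣≡∣i∣ j)

shift-invariant⇒constant : ∀ {a} {A : Set a} (c : ℤ → A) →
  (∀ n → c (n + + 1) ≡ c n) → ∀ n → c n ≡ c (+ 0)
shift-invariant⇒constant c inv (+ zero)     = refl
shift-invariant⇒constant c inv (+ suc m)    =
  trans (cong c (cong +_ (ℕ.+-comm 1 m)))
        (trans (inv (+ m)) (shift-invariant⇒constant c inv (+ m)))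
shift-invariant⇒constant c inv -[1+ zero ]  = sym (inv -[1+ zero ])
shift-invariant⇒constant c inv -[1+ suc m ] =
  trans (sym (inv -[1+ suc m ])) (shift-invariant⇒constant c inv -[1+ m ])

record FibonacciLike (s : ℤ → ℤ) : Set where
  constructor fibonacciLike
  field recurrence : ∀ n → s (n + + 2) ≡ s (n + + 1) + s n

open FibonacciLike

fibonacciLike-resp : ∀ {s t} → (∀ n → s n ≡ t n) → FibonacciLike s → FibonacciLike t
fibonacciLike-resp s≗t rec = fibonacciLike λ n →
  trans (sym (s≗t (n + + 2))) (trans (recurrence rec n) (cong₂ _+_ (s≗t (n + + 1)) (s≗t n)))

fibonacciLike-shift : ∀ {s} → FibonacciLike s → ∀ c → FibonacciLike (λ n → s (n + c))
fibonacciLike-shift {s} rec c = fibonacciLike λ n → begin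
  s (n + + 2 + c)              ≡⟨ cong s (+-right-comm n (+ 2) c) ⟩
  s (n + c + + 2)              ≡⟨ recurrence rec (n + c) ⟩
  s (n + c + + 1) + s (n + c)  ≡⟨ cong (λ m → s m + s (n + c)) (+-right-comm n c (+ 1)) ⟩
  s (n + + 1 + c) + s (n + c)  ∎
  where
  open ≡-Reasoning
  +-right-comm : ∀ n i j → n + i + j ≡ n + j + i
  +-right-comm = solve-∀

fibonacciLike-combination : ∀ {s t} → FibonacciLike s → FibonacciLike t →
  ∀ x y → FibonacciLike (λ n → x * s n - y * t n)
fibonacciLike-combination {s} {t} recs rect x y = fibonacciLike λ n →
  trans (cong₂ (λ a c → x * a - y * c) (recurrence recs n) (recurrence rect n))
        (regroup x y (s (n + + 1)) (s n) (t (n + + 1)) (t n))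
  where
  regroup : ∀ x y a b c d → x * (a + b) - y * (c + d) ≡ (x * a - y * c) + (x * b - y * d)
  regroup = solve-∀

gcd-consecutive-invariant : ∀ {s} → FibonacciLike s → ∀ m n →
  gcd (s (n + + 1)) (s n) ≡ gcd (s (m + + 1)) (s m)
gcd-consecutive-invariant {s} rec m n =
  trans (shift-invariant⇒constant c step n) (sym (shift-invariant⇒constant c step m))
  where
  c : ℤ → ℤ
  c n = gcd (s (n + + 1)) (s n)

  +1+1 : ∀ n → n + + 1 + + 1 ≡ n + + 2
  +1+1 = solve-∀

  step : ∀ n → c (n + + 1) ≡ c n
  step n = begin
    gcd (s (n + + 1 + + 1)) (s (n + + 1))  ≡⟨ cong (λ i → gcd (s i) (s (n + + 1))) (+1+1 n) ⟩
    gcd (s (n + + 2)) (s (n + + 1))        ≡⟨ cong (λ a → gcd a (s (n + + 1))) (recurrence rec n) ⟩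
    gcd (s (n + + 1) + s n) (s (n + + 1))  ≡⟨ gcd[i+j,i]≡gcd[j,i] (s (n + + 1)) (s n) ⟩
    gcd (s n) (s (n + + 1))                ≡⟨ gcd-comm (s n) (s (n + + 1)) ⟩
    c n                                    ∎
    where open ≡-Reasoning

altSign-+ : ∀ m x y → altSign m (x + y) ≡ altSign m x + altSign m y
altSign-+ zero    x y = refl
altSign-+ (suc m) x y =
  trans (cong -_ (altSign-+ m x y)) (neg-distrib-+ (altSign m x) (altSign m y))

F-recurrence : ∀ n → F (n + + 2) ≡ F (n + + 1) + F n
F-recurrence (+ n) rewrite ℕ.+-comm n 2 | ℕ.+-comm n 1 = refl
F-recurrence -[1+ 0 ]           = refl
F-recurrence -[1+ 1 ]           = refl
F-recurrence -[1+ suc (suc m) ] = sym (begin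
  - a + - - altSign m (b + c)  ≡⟨ cong (λ z → - a + - - z) (altSign-+ m b c) ⟩
  - a + - - (a + altSign m c)  ≡⟨ cancel a (altSign m c) ⟩
  altSign m c                  ∎)
  where
  open ≡-Reasoning
  a b c : ℤ
  b = + fibℕ (suc (suc m))
  c = + fibℕ (suc m)
  a = altSign m b
  cancel : ∀ a b → - a + - - (a + b) ≡ b
  cancel = solve-∀

F-fibonacciLike : FibonacciLike F
F-fibonacciLike = fibonacciLike F-recurrence

gcd[F[n+1],F[n]]≡1 : ∀ n → gcd (F (n + + 1)) (F n) ≡ + 1
gcd[F[n+1],F[n]]≡1 = gcd-consecutive-invariant F-fibonacciLike (+ 0)

-- H r k unfolds to H′ k (r - k).
H′ : ℤ → ℤ → ℤ
H′ k d = F (k + + 1) * F (d + + 2) - F k * F (d + + 1)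

H′-fibonacciLikeʳ : ∀ k → FibonacciLike (H′ k)
H′-fibonacciLikeʳ k = fibonacciLike-combination
  (fibonacciLike-shift F-fibonacciLike (+ 2)) (fibonacciLike-shift F-fibonacciLike (+ 1))
  (F (k + + 1)) (F k)

H′-fibonacciLikeˡ : ∀ d → FibonacciLike (λ k → H′ k d)
H′-fibonacciLikeˡ d = fibonacciLike-resp swap (fibonacciLike-combination
  (fibonacciLike-shift F-fibonacciLike (+ 1)) F-fibonacciLike
  (F (d + + 2)) (F (d + + 1)))
  where
  swap : ∀ k → F (d + + 2) * F (k + + 1) - F (d + + 1) * F k ≡ H′ k d
  swap k = cong₂ _-_ (*-comm (F (d + + 2)) _) (*-comm (F (d + + 1)) _)

gcd[H′[k,d+1],H′[k,d]]≡1 : ∀ k d → gcd (H′ k (d + + 1)) (H′ k d) ≡ + 1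
gcd[H′[k,d+1],H′[k,d]]≡1 k d = begin
  gcd (H′ k (d + + 1)) (H′ k d)        ≡⟨ gcd-consecutive-invariant (H′-fibonacciLikeʳ k) -[1+ 1 ] d ⟩
  gcd (H′ k -[1+ 0 ]) (H′ k -[1+ 1 ])  ≡⟨ cong₂ gcd (x*1-y*0≡x x y) (x*0-y*1≡-y x y) ⟩
  gcd x (- y)                          ≡⟨ gcd[i,-j]≡gcd[i,j] x y ⟩
  gcd (F (k + + 1)) (F k)              ≡⟨ gcd[F[n+1],F[n]]≡1 k ⟩
  + 1                                  ∎
  where
  open ≡-Reasoning
  x y : ℤ
  x = F (k + + 1)
  y = F k
  x*1-y*0≡x : ∀ x y → x * + 1 - y * + 0 ≡ x
  x*1-y*0≡x = solve-∀
  x*0-y*1≡-y : ∀ x y → x * + 0 - y * + 1 ≡ - y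
  x*0-y*1≡-y = solve-∀

gcd[H′[k+1,d],H′[k,d]]≡1 : ∀ d k → gcd (H′ (k + + 1) d) (H′ k d) ≡ + 1
gcd[H′[k+1,d],H′[k,d]]≡1 d k = begin
  gcd (H′ (k + + 1) d) (H′ k d)          ≡⟨ gcd-consecutive-invariant (H′-fibonacciLikeˡ d) -[1+ 0 ] k ⟩
  gcd (H′ (+ 0) d) (H′ -[1+ 0 ] d)       ≡⟨ cong₂ gcd (1*x-0*y≡x x y) (0*x-1*y≡-y x y) ⟩
  gcd x (- y)                            ≡⟨ gcd[i,-j]≡gcd[i,j] x y ⟩
  gcd (F (d + + 2)) (F (d + + 1))        ≡⟨ cong (λ i → gcd (F i) y) (+2≡+1+1 d) ⟩
  gcd (F (d + + 1 + + 1)) (F (d + + 1))  ≡⟨ gcd[F[n+1],F[n]]≡1 (d + + 1) ⟩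
  + 1                                    ∎
  where
  open ≡-Reasoning
  x y : ℤ
  x = F (d + + 2)
  y = F (d + + 1)
  1*x-0*y≡x : ∀ x y → + 1 * x - + 0 * y ≡ x
  1*x-0*y≡x = solve-∀
  0*x-1*y≡-y : ∀ x y → + 0 * x - + 1 * y ≡ - y
  0*x-1*y≡-y = solve-∀
  +2≡+1+1 : ∀ d → d + + 2 ≡ d + + 1 + + 1
  +2≡+1+1 = solve-∀

proposition2p1 : (r k : ℤ) → + 1 ≤ k → k ≤ r →
    (gcd (H r k) (H (r - + 1) k) ≡ + 1) × (gcd (H r k) (H (r - + 1) (k - + 1)) ≡ + 1)
proposition2p1 r k _ _ = coprime-in-r , coprime-in-r-and-k
  where
  r-k≡[r-1-k]+1 : ∀ r k → r - k ≡ r - + 1 - k + + 1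
  r-k≡[r-1-k]+1 = solve-∀
  k≡[k-1]+1 : ∀ k → k ≡ k - + 1 + + 1
  k≡[k-1]+1 = solve-∀
  r-1-[k-1]≡r-k : ∀ r k → r - + 1 - (k - + 1) ≡ r - k
  r-1-[k-1]≡r-k = solve-∀

  coprime-in-r : gcd (H r k) (H (r - + 1) k) ≡ + 1
  coprime-in-r = trans
    (cong (λ d → gcd (H′ k d) (H (r - + 1) k)) (r-k≡[r-1-k]+1 r k))
    (gcd[H′[k,d+1],H′[k,d]]≡1 k (r - + 1 - k))

  coprime-in-r-and-k : gcd (H r k) (H (r - + 1) (k - + 1)) ≡ + 1
  coprime-in-r-and-k = trans
    (cong₂ (λ i d → gcd (H′ i (r - k)) (H′ (k - + 1) d)) (k≡[k-1]+1 k) (r-1-[k-1]≡r-k r k))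
    (gcd[H′[k+1,d],H′[k,d]]≡1 (r - k) (k - + 1))
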